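{- Let $\Sigma$ be a signed graph and let $W$ be a weakly negative circle in $\Sigma$ that is edge-disjoint from every other weakly negative circle of $\Sigma$. Then $W$ has at most one vertex in common with each all-positive circle of $\Sigma$, and at most one vertex in common with each weakly negative circle of $\Sigma$ other than $W$.
   Context: A signed graph $\Sigma=(\Gamma,\sigma)$ consists of a graph $\Gamma=(V,E)$ (multiple edges allowed, no loops) and a sign function $\sigma:E\to\{+,-\}$. A circle is a cycle (polygon) of the graph; with multiple edges, two parallel edges form a circle of length 2. A circle is all positive if all its edges are positive, and weakly negative if exactly one of its edges is negative. -}

module Defs where

open import Data.Nat using (ℕ; suc)
open import Data.Nat.DivMod using (_%_)
open import Data.Fin using (Fin; toℕ)
open import Data.Product using (_×_; _,_; proj₁; proj₂; ∃; Σ-syntax)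
open import Data.Sum using (_⊎_)
open import Relation.Binary.PropositionalEquality using (_≡_; _≢_)
open import Relation.Nullary using (¬_)
open import Function.Definitions using (Injective)

data Sign : Set where
  pos neg : Sign

-- Multiple edges are allowed (distinct edges may share endpoints);
-- loops are forbidden (the two endpoints of each edge are distinct).
record SignedGraph (n m : ℕ) : Set where
  field
    ends   : Fin m → Fin n × Fin n
    noLoop : (e : Fin m) → proj₁ (ends e) ≢ proj₂ (ends e)
    sign   : Fin m → Sign
open SignedGraph public

Joins : ∀ {n m} → SignedGraph n m → Fin m → Fin n → Fin n → Set
Joins Γ e u v = (ends Γ e ≡ (u , v)) ⊎ (ends Γ e ≡ (v , u))

-- Length 2 circles are pairs of distinct parallel edges.
record Circle {n m : ℕ} (Γ : SignedGraph n m) : Set where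
  field
    len    : ℕ            -- the circle has len + 2 edges
    vert   : Fin (suc (suc len)) → Fin n
    edge   : Fin (suc (suc len)) → Fin m
    vertInj : Injective _≡_ _≡_ vert
    edgeInj : Injective _≡_ _≡_ edge
    joins  : (i j : Fin (suc (suc len))) →
             toℕ j ≡ suc (toℕ i) % suc (suc len) →
             Joins Γ (edge i) (vert i) (vert j)
open Circle public

module _ {n m : ℕ} {Γ : SignedGraph n m} where

  _∈E_ : Fin m → Circle Γ → Set
  e ∈E C = ∃ λ i → edge C i ≡ e

  _∈V_ : Fin n → Circle Γ → Set
  v ∈V C = ∃ λ i → vert C i ≡ v

  -- circles are identified with their edge sets
  SameCircle : Circle Γ → Circle Γ → Set
  SameCircle C D = ∀ e → (e ∈E C → e ∈E D) × (e ∈E D → e ∈E C)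

  EdgeDisjoint : Circle Γ → Circle Γ → Set
  EdgeDisjoint C D = ∀ e → e ∈E C → ¬ (e ∈E D)

  AllPositive : Circle Γ → Set
  AllPositive C = ∀ i → sign Γ (edge C i) ≡ pos

  WeaklyNegative : Circle Γ → Set
  WeaklyNegative C =
    Σ[ i ∈ Fin (suc (suc (len C))) ]
      (sign Γ (edge C i) ≡ neg × (∀ j → sign Γ (edge C j) ≡ neg → j ≡ i))

  AtMostOneCommonVertex : Circle Γ → Circle Γ → Set
  AtMostOneCommonVertex C D =
    ∀ u v → u ∈V C → u ∈V D → v ∈V C → v ∈V D → u ≡ v

-- Suppose a circle C meets W in two distinct vertices.  If every edge of C lies on W, then C = W,
-- which is impossible: C is all positive, or C ≠ W is edge-disjoint from W.  Otherwise, walking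
-- along C from the last W-vertex before an edge off W to the next W-vertex gives a bridge of W:
-- a path between distinct vertices x, y of W that meets W nowhere else.  The two arcs of W between
-- x and y close the bridge into two circles, exactly one of which contains the negative edge e* of
-- W, and the bridge, being part of C, has at most one negative edge.  If it has one, the circle
-- avoiding e* is weakly negative; otherwise the circle through e* is.  Either way this is a weakly
-- negative circle other than W sharing an edge with W.

module Submission where

open import Defs
open import Data.Nat using (ℕ; zero; suc; _+_; _*_; _∸_; _<_; _≤_; _<?_; z≤n; s≤s; z<s; s<s; s≤s⁻¹)
open import Data.Nat.Properties
open import Data.Nat.DivMod
  using (_%_; _mod_; %-distribˡ-+; [m+kn]%n≡m%n; [m+n]%n≡m%n; m%n%n≡m%n; m<n⇒m%n≡m; m%n<n; n%n≡0)
open import Data.Nat.Tactic.RingSolver using (solve-∀)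
open import Data.Fin using (Fin; zero; toℕ; fromℕ<)
open import Data.Fin.Properties using (toℕ-fromℕ<; toℕ-injective; toℕ<n; any?; all?; ¬∀⟶∃¬)
  renaming (_≟_ to _≟ᶠ_)
open import Data.Product using (Σ; _×_; _,_; proj₁; proj₂; ∃)
open import Data.Sum using (_⊎_; inj₁; inj₂; [_,_]; map₂)
open import Data.Empty using (⊥; ⊥-elim)
open import Function using (_∘_; id; flip)
open import Function.Definitions using (Injective)
open import Relation.Nullary using (¬_; Dec; yes; no; contradiction)
open import Relation.Unary using (Decidable)
open import Relation.Binary.PropositionalEquality
  using (_≡_; _≢_; refl; sym; trans; cong; subst; module ≡-Reasoning)

module _ {k : ℕ} where

  %-congʳ-+ : ∀ c {x y} → x % suc k ≡ y % suc k → (c + x) % suc k ≡ (c + y) % suc k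
  %-congʳ-+ c {x} {y} x≡y = begin
    (c + x) % suc k                   ≡⟨ %-distribˡ-+ c x (suc k) ⟩
    (c % suc k + x % suc k) % suc k   ≡⟨ cong (λ z → (c % suc k + z) % suc k) x≡y ⟩
    (c % suc k + y % suc k) % suc k   ≡⟨ %-distribˡ-+ c y (suc k) ⟨
    (c + y) % suc k                   ∎
    where open ≡-Reasoning

  %-cancelˡ-+ : ∀ c {x y} → (c + x) % suc k ≡ (c + y) % suc k → x % suc k ≡ y % suc k
  %-cancelˡ-+ c {x} {y} c+x≡c+y = begin
    x % suc k                   ≡⟨ [m+kn]%n≡m%n x c (suc k) ⟨
    (x + c * suc k) % suc k     ≡⟨ cong (_% suc k) (shift x c k) ⟩
    (k * c + (c + x)) % suc k   ≡⟨ %-congʳ-+ (k * c) c+x≡c+y ⟩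
    (k * c + (c + y)) % suc k   ≡⟨ cong (_% suc k) (shift y c k) ⟨
    (y + c * suc k) % suc k     ≡⟨ [m+kn]%n≡m%n y c (suc k) ⟩
    y % suc k                   ∎
    where
      open ≡-Reasoning
      shift : ∀ z c k → z + c * suc k ≡ k * c + (c + z)
      shift = solve-∀

  %-injectiveʳ-+ : ∀ c {x y} → x < suc k → y < suc k → (c + x) % suc k ≡ (c + y) % suc k → x ≡ y
  %-injectiveʳ-+ c {x} {y} x<k y<k c+x≡c+y =
    trans (sym (m<n⇒m%n≡m x<k)) (trans (%-cancelˡ-+ c c+x≡c+y) (m<n⇒m%n≡m y<k))

  %-surjectiveʳ-+ : ∀ c {b} → b < suc k → ∃ λ o → o < suc k × (c + o) % suc k ≡ b
  %-surjectiveʳ-+ c {b} b<k = o , m%n<n (b + k * c) (suc k) , (begin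
    (c + o) % suc k             ≡⟨ %-congʳ-+ c (m%n%n≡m%n (b + k * c) (suc k)) ⟩
    (c + (b + k * c)) % suc k   ≡⟨ cong (_% suc k) (unshift c b k) ⟩
    (b + c * suc k) % suc k     ≡⟨ [m+kn]%n≡m%n b c (suc k) ⟩
    b % suc k                   ≡⟨ m<n⇒m%n≡m b<k ⟩
    b                           ∎)
    where
      open ≡-Reasoning
      o = (b + k * c) % suc k
      unshift : ∀ c b k → c + (b + k * c) ≡ b + c * suc k
      unshift = solve-∀

module _ {a} {A : Set a} {k : ℕ} (f : Fin (suc k) → A) where

  cyclic : ℕ → A
  cyclic i = f (i mod suc k)

  cyclic-cong : ∀ i j → i % suc k ≡ j % suc k → cyclic i ≡ cyclic j
  cyclic-cong i j i≡j = cong f (toℕ-injective (begin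
    toℕ (i mod suc k)   ≡⟨ toℕ-fromℕ< (m%n<n i (suc k)) ⟩
    i % suc k           ≡⟨ i≡j ⟩
    j % suc k           ≡⟨ toℕ-fromℕ< (m%n<n j (suc k)) ⟨
    toℕ (j mod suc k)   ∎))
    where open ≡-Reasoning

  cyclic-toℕ : ∀ t → cyclic (toℕ t) ≡ f t
  cyclic-toℕ t = cong f (toℕ-injective (trans (toℕ-fromℕ< _) (m<n⇒m%n≡m (toℕ<n t))))

  cyclic-periodic : ∀ i → cyclic (i + suc k) ≡ cyclic i
  cyclic-periodic i = cyclic-cong (i + suc k) i ([m+n]%n≡m%n i (suc k))

  cyclic-offset : ∀ B t → ∃ λ o → o < suc k × cyclic (B + o) ≡ f t
  cyclic-offset B t with %-surjectiveʳ-+ B (toℕ<n t)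
  ... | o , o<k , B+o≡t =
    o , o<k , trans (cyclic-cong (B + o) (toℕ t) (trans B+o≡t (sym (m<n⇒m%n≡m (toℕ<n t))))) (cyclic-toℕ t)

  module _ (f-injective : Injective _≡_ _≡_ f) where

    cyclic-injective : ∀ {i j} → cyclic i ≡ cyclic j → i % suc k ≡ j % suc k
    cyclic-injective {i} {j} fi≡fj = begin
      i % suc k           ≡⟨ toℕ-fromℕ< (m%n<n i (suc k)) ⟨
      toℕ (i mod suc k)   ≡⟨ cong toℕ (f-injective fi≡fj) ⟩
      toℕ (j mod suc k)   ≡⟨ toℕ-fromℕ< (m%n<n j (suc k)) ⟩
      j % suc k           ∎
      where open ≡-Reasoning

    cyclic-injectiveOn : ∀ B {x y} → x < suc k → y < suc k → cyclic (B + x) ≡ cyclic (B + y) → x ≡ y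
    cyclic-injectiveOn B {x} {y} x<k y<k =
      %-injectiveʳ-+ B x<k y<k ∘ cyclic-injective {B + x} {B + y}

InjectiveBelow : ∀ {a} {A : Set a} → ℕ → (ℕ → A) → Set a
InjectiveBelow K f = ∀ {i j} → i < K → j < K → f i ≡ f j → i ≡ j

data Position (p : ℕ) : ℕ → Set where
  before : ∀ {i} → i < p → Position p i
  after  : ∀ j → Position p (p + j)

position : ∀ p i → Position p i
position p i with i <? p
... | yes i<p = before i<p
... | no i≮p  = subst (Position p) (m+[n∸m]≡n (≮⇒≥ i≮p)) (after (i ∸ p))

-- Opaque, so that p, f and g are inferred from goals mentioning splice p f g i.
opaque

  splice : ∀ {a} {A : Set a} → ℕ → (ℕ → A) → (ℕ → A) → ℕ → A
  splice p f g i with i <? p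
  ... | yes _ = f i
  ... | no _  = g (i ∸ p)

opaque
  unfolding splice

  splice-< : ∀ {a} {A : Set a} {p} {f g : ℕ → A} {i} → i < p → splice p f g i ≡ f i
  splice-< {p = p} {i = i} i<p with i <? p
  ... | yes _   = refl
  ... | no i≮p = contradiction i<p i≮p

  splice-+ : ∀ {a} {A : Set a} {p} {f g : ℕ → A} j → splice p f g (p + j) ≡ g j
  splice-+ {p = p} {g = g} j with p + j <? p
  ... | yes p+j<p = contradiction p+j<p (m+n≮m p j)
  ... | no _      = cong g (m+n∸m≡n p j)

splice-≤ : ∀ {a} {A : Set a} {p} {f g : ℕ → A} → g 0 ≡ f p → ∀ {i} → i ≤ p → splice p f g i ≡ f i
splice-≤ {p = p} {f} {g} g0≡fp i≤p with m≤n⇒m<n∨m≡n i≤p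
... | inj₁ i<p  = splice-< i<p
... | inj₂ refl = trans (cong (splice p f g) (sym (+-identityʳ p))) (trans (splice-+ 0) g0≡fp)

module _ {a} {A : Set a} {p : ℕ} {f g : ℕ → A} where

  splice-injective : ∀ {q} → InjectiveBelow p f → InjectiveBelow q g →
                     (∀ {i j} → i < p → j < q → f i ≢ g j) → InjectiveBelow (p + q) (splice p f g)
  splice-injective {q} f-inj g-inj f≢g {i} {j} i<p+q j<p+q fi≡fj with position p i | position p j
  ... | before i<p | before j<p = f-inj i<p j<p (trans (sym (splice-< i<p)) (trans fi≡fj (splice-< j<p)))
  ... | before i<p | after j′   =
    contradiction (trans (sym (splice-< i<p)) (trans fi≡fj (splice-+ j′))) (f≢g i<p (+-cancelˡ-< p j′ q j<p+q))
  ... | after i′   | before j<p =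
    contradiction (trans (sym (splice-< j<p)) (trans (sym fi≡fj) (splice-+ i′))) (f≢g j<p (+-cancelˡ-< p i′ q i<p+q))
  ... | after i′   | after j′   = cong (p +_) (g-inj (+-cancelˡ-< p i′ q i<p+q) (+-cancelˡ-< p j′ q j<p+q)
                                    (trans (sym (splice-+ i′)) (trans fi≡fj (splice-+ j′))))

record Gap {q} (Q : ℕ → Set q) (a o b : ℕ) : Set q where
  field
    start    : ℕ
    width    : ℕ
    a≤start  : a ≤ start
    start≤o  : start ≤ o
    o<end    : o < start + width
    end≤b    : start + width ≤ b
    Q-start  : Q start
    Q-end    : Q (start + width)
    interior : ∀ {i} → 0 < i → i < width → ¬ Q (start + i)

module _ {q} {Q : ℕ → Set q} (Q? : Decidable Q) where

  lastUpTo : ∀ {a o} → Q a → a ≤ o → ∃ λ r → a ≤ r × r ≤ o × Q r × (∀ {t} → r < t → t ≤ o → ¬ Q t)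
  lastUpTo {o = zero} Qa z≤n = 0 , z≤n , z≤n , Qa , λ r<t t≤0 → contradiction t≤0 (<⇒≱ r<t)
  lastUpTo {o = suc o} Qa a≤1+o with Q? (suc o)
  ... | yes Q1+o = suc o , a≤1+o , ≤-refl , Q1+o , λ r<t t≤1+o → contradiction t≤1+o (<⇒≱ r<t)
  ... | no ¬Q1+o with m≤n⇒m<n∨m≡n a≤1+o
  ...   | inj₂ refl   = contradiction Qa ¬Q1+o
  ...   | inj₁ a<1+o with lastUpTo Qa (s≤s⁻¹ a<1+o)
  ...     | r , a≤r , r≤o , Qr , none≤o = r , a≤r , m≤n⇒m≤1+n r≤o , Qr , none≤1+o
    where
      none≤1+o : ∀ {t} → r < t → t ≤ suc o → ¬ Q t
      none≤1+o r<t t≤1+o with m≤n⇒m<n∨m≡n t≤1+o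
      ... | inj₁ t<1+o = none≤o r<t (s≤s⁻¹ t<1+o)
      ... | inj₂ refl  = ¬Q1+o

  firstFrom : ∀ a d → Q (a + d) → ∃ λ e → e ≤ d × Q (a + e) × (∀ {e′} → e′ < e → ¬ Q (a + e′))
  firstFrom a zero    Qa       = 0 , z≤n , Qa , λ ()
  firstFrom a (suc d) Qa+1+d with Q? (a + 0)
  ... | yes Qa = 0 , z≤n , Qa , λ ()
  ... | no ¬Qa with firstFrom (suc a) d (subst Q (+-suc a d) Qa+1+d)
  ...   | e , e≤d , Q1+a+e , none< = suc e , s≤s e≤d , subst Q (sym (+-suc a e)) Q1+a+e , none≤
    where
      none≤ : ∀ {e′} → e′ < suc e → ¬ Q (a + e′)
      none≤ {zero}   _            = ¬Qa
      none≤ {suc e′} (s≤s e′<e) = none< e′<e ∘ subst Q (+-suc a e′)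

  gap : ∀ {a o b} → Q a → Q b → a ≤ o → o < b → Gap Q a o b
  gap {a} {o} {b} Qa Qb a≤o o<b with lastUpTo Qa a≤o
  ... | r , a≤r , r≤o , Qr , none≤o
      with firstFrom (suc r) (b ∸ suc r) (subst Q (sym (m+[n∸m]≡n (≤-<-trans r≤o o<b))) Qb)
  ...   | e , e≤d , Qe , none< = record
    { start    = r
    ; width    = suc e
    ; a≤start  = a≤r
    ; start≤o  = r≤o
    ; o<end    = ≰⇒> (λ end≤o → none≤o (m<m+n r z<s) end≤o Q-end)
    ; end≤b    = subst (_≤ b) (sym (+-suc r e))
                   (≤-trans (+-monoʳ-≤ (suc r) e≤d) (≤-reflexive (m+[n∸m]≡n (≤-<-trans r≤o o<b))))
    ; Q-start  = Qr
    ; Q-end    = Q-end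
    ; interior = λ { {suc i} _ (s≤s i<e) → none< i<e ∘ subst Q (+-suc r i) }
    }
    where
      Q-end : Q (r + suc e)
      Q-end = subst Q (sym (+-suc r e)) Qe

module _ {n m : ℕ} (Γ : SignedGraph n m) where

  Joins-sym : ∀ {e a b} → Joins Γ e a b → Joins Γ e b a
  Joins-sym (inj₁ e≡ab) = inj₂ e≡ab
  Joins-sym (inj₂ e≡ba) = inj₁ e≡ba

  Joins-endpoint : ∀ {e a b c d} → Joins Γ e a b → Joins Γ e c d → c ≡ a ⊎ c ≡ b
  Joins-endpoint (inj₁ p) (inj₁ q) = inj₁ (cong proj₁ (trans (sym q) p))
  Joins-endpoint (inj₁ p) (inj₂ q) = inj₂ (cong proj₂ (trans (sym q) p))
  Joins-endpoint (inj₂ p) (inj₁ q) = inj₂ (cong proj₁ (trans (sym q) p))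
  Joins-endpoint (inj₂ p) (inj₂ q) = inj₁ (cong proj₂ (trans (sym q) p))

  Joins-cong : ∀ {e e′ a a′ b b′} → e ≡ e′ → a ≡ a′ → b ≡ b′ → Joins Γ e a b → Joins Γ e′ a′ b′
  Joins-cong refl refl refl e-joins = e-joins

  size : Circle Γ → ℕ
  size C = suc (suc (len C))

  cyclicVertex : Circle Γ → ℕ → Fin n
  cyclicVertex C = cyclic (vert C)

  cyclicEdge : Circle Γ → ℕ → Fin m
  cyclicEdge C = cyclic (edge C)

  ∈V? : (C : Circle Γ) → ∀ v → Dec (v ∈V C)
  ∈V? C v = any? (λ t → vert C t ≟ᶠ v)

  ∈E? : (C : Circle Γ) → ∀ e → Dec (e ∈E C)
  ∈E? C e = any? (λ t → edge C t ≟ᶠ e)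

  module _ (C : Circle Γ) where

    cyclicVertex-∈V : ∀ i → cyclicVertex C i ∈V C
    cyclicVertex-∈V i = _ , refl

    cyclicEdge-∈E : ∀ i → cyclicEdge C i ∈E C
    cyclicEdge-∈E i = _ , refl

    cyclicEdge-joins : ∀ i → Joins Γ (cyclicEdge C i) (cyclicVertex C i) (cyclicVertex C (suc i))
    cyclicEdge-joins i = joins C (i mod size C) (suc i mod size C) (begin
      toℕ (suc i mod size C)              ≡⟨ toℕ-fromℕ< (m%n<n (suc i) (size C)) ⟩
      suc i % size C                      ≡⟨ %-congʳ-+ 1 {i % size C} {i} (m%n%n≡m%n i (size C)) ⟨
      suc (i % size C) % size C           ≡⟨ cong (λ z → suc z % size C) (toℕ-fromℕ< (m%n<n i (size C))) ⟨
      suc (toℕ (i mod size C)) % size C   ∎)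
      where open ≡-Reasoning

    ∈E-joins⇒∈V : ∀ {e a b} → e ∈E C → Joins Γ e a b → a ∈V C
    ∈E-joins⇒∈V {a = a} (t , refl) e-joins
      with Joins-endpoint (Joins-cong (cyclic-toℕ (edge C) t) refl refl (cyclicEdge-joins (toℕ t))) e-joins
    ... | inj₁ a≡ = subst (_∈V C) (sym a≡) (cyclicVertex-∈V (toℕ t))
    ... | inj₂ a≡ = subst (_∈V C) (sym a≡) (cyclicVertex-∈V (suc (toℕ t)))

  cyclicEdge-≢-suc : (C : Circle Γ) → ∀ j → cyclicEdge C j ≢ cyclicEdge C (suc j)
  cyclicEdge-≢-suc C j eq with cyclic-injectiveOn (edge C) (edgeInj C) j {0} {1} z<s (s<s z<s)
    (trans (cong (cyclicEdge C) (+-identityʳ j)) (trans eq (cong (cyclicEdge C) (+-comm 1 j))))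
  ... | ()

  ∈E-incident : (C : Circle Γ) → ∀ {e t y} → e ∈E C → Joins Γ e (cyclicVertex C (suc t)) y →
                e ≡ cyclicEdge C t ⊎ e ≡ cyclicEdge C (suc t)
  ∈E-incident C {t = t} (s , refl) e-joins
    with Joins-endpoint (Joins-cong (cyclic-toℕ (edge C) s) refl refl (cyclicEdge-joins C (toℕ s))) e-joins
  ... | inj₁ 1+t≡s   = inj₂ (trans (sym (cyclic-toℕ (edge C) s))
                           (cyclic-cong (edge C) (toℕ s) (suc t) (sym 1+t≡s′)))
    where 1+t≡s′ = cyclic-injective (vert C) (vertInj C) {suc t} {toℕ s} 1+t≡s
  ... | inj₂ 1+t≡1+s = inj₁ (trans (sym (cyclic-toℕ (edge C) s))
                           (cyclic-cong (edge C) (toℕ s) t (sym (%-cancelˡ-+ 1 {t} {toℕ s} 1+t≡1+s′))))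
    where 1+t≡1+s′ = cyclic-injective (vert C) (vertInj C) {suc t} {suc (toℕ s)} 1+t≡1+s

  module _ (W C : Circle Γ) (C⊆W : ∀ {e} → e ∈E C → e ∈E W) where

    private
      -- The two C-edges at a common vertex are distinct W-edges at it, so one of them is the
      -- W-edge before it.
      stepAt : ∀ t j → cyclicVertex C (suc j) ≡ cyclicVertex W (suc t) → cyclicEdge W t ∈E C
      stepAt t j w≡
        with ∈E-incident W {t = t} (C⊆W (cyclicEdge-∈E C j))
               (Joins-cong refl w≡ refl (Joins-sym (cyclicEdge-joins C j)))
           | ∈E-incident W {t = t} (C⊆W (cyclicEdge-∈E C (suc j)))
               (Joins-cong refl w≡ refl (cyclicEdge-joins C (suc j)))
      ... | inj₁ Cj≡Wt   | _             = subst (_∈E C) Cj≡Wt (cyclicEdge-∈E C j)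
      ... | inj₂ _       | inj₁ C1+j≡Wt  = subst (_∈E C) C1+j≡Wt (cyclicEdge-∈E C (suc j))
      ... | inj₂ Cj≡W1+t | inj₂ C1+j≡W1+t = ⊥-elim (cyclicEdge-≢-suc C j (trans Cj≡W1+t (sym C1+j≡W1+t)))

      -- Position toℕ c + suc (len C) is toℕ c - 1 modulo size C.
      step : ∀ t → cyclicVertex W (suc t) ∈V C → cyclicEdge W t ∈E C
      step t (c , c≡) = stepAt t (toℕ c + suc (len C)) (begin
        cyclicVertex C (suc (toℕ c + suc (len C)))   ≡⟨ cong (cyclicVertex C) (+-suc (toℕ c) (suc (len C))) ⟨
        cyclicVertex C (toℕ c + size C)              ≡⟨ cyclic-periodic (vert C) (toℕ c) ⟩
        cyclicVertex C (toℕ c)                       ≡⟨ cyclic-toℕ (vert C) c ⟩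
        vert C c                                     ≡⟨ c≡ ⟩
        cyclicVertex W (suc t)                       ∎)
        where open ≡-Reasoning

      descend : ∀ t d → cyclicVertex W (t + d) ∈V C → cyclicVertex W t ∈V C
      descend t zero    = subst (_∈V C) (cong (cyclicVertex W) (+-identityʳ t))
      descend t (suc d) = descend t d ∘ flip (∈E-joins⇒∈V C) (cyclicEdge-joins W (t + d)) ∘ step (t + d)
                            ∘ subst (_∈V C) (cong (cyclicVertex W) (+-suc t d))

    circle⊆circle⇒⊇ : ∀ {e} → e ∈E W → e ∈E C
    circle⊆circle⇒⊇ (s , refl) with ∈E-joins⇒∈V W (C⊆W (cyclicEdge-∈E C 0)) (cyclicEdge-joins C 0)
    ... | t , t≡C₀ = subst (_∈E C) (cyclic-toℕ (edge W) s)
                       (step (toℕ s) (descend (suc (toℕ s)) d (subst (_∈V C) (sym W[1+s+d]≡C₀) (cyclicVertex-∈V C 0))))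
      where
        open ≡-Reasoning
        d = toℕ t + size W ∸ suc (toℕ s)
        1+s≤t+size = ≤-trans (toℕ<n s) (m≤n+m (size W) (toℕ t))
        W[1+s+d]≡C₀ : cyclicVertex W (suc (toℕ s) + d) ≡ cyclicVertex C 0
        W[1+s+d]≡C₀ = begin
          cyclicVertex W (suc (toℕ s) + d)   ≡⟨ cong (cyclicVertex W) (m+[n∸m]≡n 1+s≤t+size) ⟩
          cyclicVertex W (toℕ t + size W)    ≡⟨ cyclic-periodic (vert W) (toℕ t) ⟩
          cyclicVertex W (toℕ t)             ≡⟨ cyclic-toℕ (vert W) t ⟩
          vert W t                           ≡⟨ t≡C₀ ⟩
          cyclicVertex C 0                   ∎

  record Path : Set where
    field
      length             : ℕ
      vertexAt           : ℕ → Fin n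
      edgeAt             : ℕ → Fin m
      edgeAt-joins       : ∀ {i} → i < length → Joins Γ (edgeAt i) (vertexAt i) (vertexAt (suc i))
      vertexAt-injective : InjectiveBelow (suc length) vertexAt
      edgeAt-injective   : InjectiveBelow length edgeAt

  record ClosedPath : Set where
    field
      length             : ℕ
      2≤length           : 2 ≤ length
      vertexAt           : ℕ → Fin n
      edgeAt             : ℕ → Fin m
      edgeAt-joins       : ∀ {i} → i < length → Joins Γ (edgeAt i) (vertexAt i) (vertexAt (suc i))
      closed             : vertexAt length ≡ vertexAt 0
      vertexAt-injective : InjectiveBelow length vertexAt
      edgeAt-injective   : InjectiveBelow length edgeAt

  module _ (Z : ClosedPath) where
    open ClosedPath Z

    private
      L = length ∸ 2

      2+L≡length : suc (suc L) ≡ length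
      2+L≡length = m+[n∸m]≡n 2≤length

      toℕ<length : (t : Fin (suc (suc L))) → toℕ t < length
      toℕ<length t = subst (toℕ t <_) 2+L≡length (toℕ<n t)

      vertexAt-% : ∀ {x} → x ≤ suc (suc L) → vertexAt (x % suc (suc L)) ≡ vertexAt x
      vertexAt-% x≤K with m≤n⇒m<n∨m≡n x≤K
      ... | inj₁ x<K  = cong vertexAt (m<n⇒m%n≡m x<K)
      ... | inj₂ refl = trans (cong vertexAt (n%n≡0 (suc (suc L))))
                              (trans (sym closed) (cong vertexAt (sym 2+L≡length)))

    toCircle : Circle Γ
    toCircle = record
      { len     = L
      ; vert    = vertexAt ∘ toℕ
      ; edge    = edgeAt ∘ toℕ
      ; vertInj = λ {s} {t} → toℕ-injective ∘ vertexAt-injective (toℕ<length s) (toℕ<length t)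
      ; edgeInj = λ {s} {t} → toℕ-injective ∘ edgeAt-injective (toℕ<length s) (toℕ<length t)
      ; joins   = λ s t t≡1+s →
          Joins-cong refl refl (trans (sym (vertexAt-% (toℕ<n s))) (cong vertexAt (sym t≡1+s)))
            (edgeAt-joins (toℕ<length s))
      }

    ∈E-toCircle⁺ : ∀ {i} → i < length → edgeAt i ∈E toCircle
    ∈E-toCircle⁺ {i} i<length = fromℕ< i<K , cong edgeAt (toℕ-fromℕ< i<K)
      where i<K = subst (i <_) (sym 2+L≡length) i<length

    ∈E-toCircle⁻ : ∀ {e} → e ∈E toCircle → ∃ λ i → i < length × edgeAt i ≡ e
    ∈E-toCircle⁻ (t , refl) = toℕ t , toℕ<length t , refl

  open Path

  _∈Eₚ_ : Fin m → Path → Set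
  e ∈Eₚ P = ∃ λ i → i < length P × edgeAt P i ≡ e

  segment : (C : Circle Γ) (B p : ℕ) → p < size C → Path
  segment C B p p<size = record
    { length             = p
    ; vertexAt           = λ i → cyclicVertex C (B + i)
    ; edgeAt             = λ i → cyclicEdge C (B + i)
    ; edgeAt-joins       = λ {i} _ →
        Joins-cong refl refl (cong (cyclicVertex C) (sym (+-suc B i))) (cyclicEdge-joins C (B + i))
    ; vertexAt-injective = λ i≤p j≤p →
        cyclic-injectiveOn (vert C) (vertInj C) B (≤-<-trans (s≤s⁻¹ i≤p) p<size) (≤-<-trans (s≤s⁻¹ j≤p) p<size)
    ; edgeAt-injective   = λ i<p j<p →
        cyclic-injectiveOn (edge C) (edgeInj C) B (<-trans i<p p<size) (<-trans j<p p<size)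
    }

  ∈Eₚ-segment⇒∈E : ∀ C B p p<size {e} → e ∈Eₚ segment C B p p<size → e ∈E C
  ∈Eₚ-segment⇒∈E C B p p<size (i , _ , refl) = cyclicEdge-∈E C (B + i)

  reverse : Path → Path
  reverse P = record
    { length             = p
    ; vertexAt           = λ i → vertexAt P (p ∸ i)
    ; edgeAt             = λ i → edgeAt P (p ∸ suc i)
    ; edgeAt-joins       = λ i<p →
        Joins-sym (Joins-cong refl refl (cong (vertexAt P) (1+[p∸1+i]≡p∸i i<p)) (edgeAt-joins P (p∸1+i<p i<p)))
    ; vertexAt-injective = λ {i} {j} i≤p j≤p p∸i≡p∸j →
        ∸-cancelˡ-≡ (s≤s⁻¹ i≤p) (s≤s⁻¹ j≤p) (vertexAt-injective P (s≤s (m∸n≤m p i)) (s≤s (m∸n≤m p j)) p∸i≡p∸j)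
    ; edgeAt-injective   = λ i<p j<p p∸1+i≡p∸1+j →
        suc-injective (∸-cancelˡ-≡ i<p j<p (edgeAt-injective P (p∸1+i<p i<p) (p∸1+i<p j<p) p∸1+i≡p∸1+j))
    }
    where
      p = length P
      1+[p∸1+i]≡p∸i : ∀ {i} → i < p → suc (p ∸ suc i) ≡ p ∸ i
      1+[p∸1+i]≡p∸i i<p = sym (+-∸-assoc 1 i<p)
      p∸1+i<p : ∀ {i} → i < p → p ∸ suc i < p
      p∸1+i<p {i} i<p = subst (_≤ p) (sym (1+[p∸1+i]≡p∸i i<p)) (m∸n≤m p i)

  reverse-end : ∀ P → vertexAt (reverse P) (length P) ≡ vertexAt P 0
  reverse-end P = cong (vertexAt P) (n∸n≡0 (length P))

  ∈Eₚ-reverse⁻ : ∀ {e} P → e ∈Eₚ reverse P → e ∈Eₚ P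
  ∈Eₚ-reverse⁻ P (i , i<p , refl) = length P ∸ suc i , ∸-monoʳ-< z<s i<p , refl

  ∈Eₚ-reverse⁺ : ∀ {e} P → e ∈Eₚ P → e ∈Eₚ reverse P
  ∈Eₚ-reverse⁺ P (i , i<p , refl) =
    p ∸ suc i , ∸-monoʳ-< z<s i<p ,
    cong (edgeAt P) (trans (cong (p ∸_) (sym (+-∸-assoc 1 i<p))) (m∸[m∸n]≡n (<⇒≤ i<p)))
    where p = length P

  coSegment : (C : Circle Γ) (B : ℕ) {q : ℕ} → 0 < q → q < size C → Path
  coSegment C B {q} 0<q q<size = segment C (B + q) (size C ∸ q) (∸-monoʳ-< 0<q (<⇒≤ q<size))

  ∈E-segment⊎coSegment : (C : Circle Γ) (B : ℕ) {q : ℕ} (0<q : 0 < q) (q<size : q < size C) →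
    ∀ {e} → e ∈E C →
    (e ∈Eₚ segment C B q q<size × ¬ e ∈Eₚ coSegment C B 0<q q<size) ⊎
    (e ∈Eₚ coSegment C B 0<q q<size × ¬ e ∈Eₚ segment C B q q<size)
  ∈E-segment⊎coSegment C B {q} 0<q q<size (t , refl) with cyclic-offset (edge C) B t
  ... | o , o<size , Bo≡t with o <? q
  ...   | yes o<q = inj₁ ((o , o<q , Bo≡t) , λ { (j , j<size∸q , Bqj≡t) →
            <⇒≱ o<q (≤-trans (m≤m+n q j) (≤-reflexive (sameEdge (q+j<size j<size∸q) o<size
              (trans (cong (cyclicEdge C) (sym (+-assoc B q j))) (trans Bqj≡t (sym Bo≡t)))))) })
    where
      sameEdge = cyclic-injectiveOn (edge C) (edgeInj C) B
      q+j<size : ∀ {j} → j < size C ∸ q → q + j < size C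
      q+j<size {j} j< = subst (q + j <_) (m+[n∸m]≡n (<⇒≤ q<size)) (+-monoʳ-< q j<)
  ...   | no o≮q  = inj₂ ((o ∸ q , ∸-monoˡ-< o<size q≤o , trans (cong (cyclicEdge C) B+q+[o∸q]≡B+o) Bo≡t) ,
                          λ { (j , j<q , Bj≡t) → <⇒≱ j<q (≤-trans q≤o (≤-reflexive
                                (sameEdge o<size (<-trans j<q q<size) (trans Bo≡t (sym Bj≡t))))) })
    where
      sameEdge = cyclic-injectiveOn (edge C) (edgeInj C) B
      q≤o = ≮⇒≥ o≮q
      B+q+[o∸q]≡B+o : B + q + (o ∸ q) ≡ B + o
      B+q+[o∸q]≡B+o = trans (+-assoc B q (o ∸ q)) (cong (B +_) (m+[n∸m]≡n q≤o))

  record Closable (P Q : Path) : Set where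
    field
      P-nonempty       : 0 < length P
      Q-nonempty       : 0 < length Q
      P→Q              : vertexAt Q 0 ≡ vertexAt P (length P)
      Q→P              : vertexAt Q (length Q) ≡ vertexAt P 0
      P-interior∉Q     : ∀ {i j} → 0 < i → i < length P → j ≤ length Q → vertexAt P i ≢ vertexAt Q j
      edges-disjoint   : ∀ {e} → e ∈Eₚ P → ¬ e ∈Eₚ Q

  module _ {P Q : Path} (PQ : Closable P Q) where
    open Closable PQ

    private
      p = length P
      q = length Q

      P-vertex≢Q-vertex : ∀ {i j} → i < p → j < q → vertexAt P i ≢ vertexAt Q j
      P-vertex≢Q-vertex {zero}  _   j<q P0≡Qj =
        <⇒≢ j<q (vertexAt-injective Q (m<n⇒m<1+n j<q) ≤-refl (trans (sym P0≡Qj) (sym Q→P)))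
      P-vertex≢Q-vertex {suc i} i<p j<q = P-interior∉Q z<s i<p (<⇒≤ j<q)

      splice-joins : ∀ {i} → i < p + q →
        Joins Γ (splice p (edgeAt P) (edgeAt Q) i) (splice p (vertexAt P) (vertexAt Q) i)
                (splice p (vertexAt P) (vertexAt Q) (suc i))
      splice-joins {i} i<p+q with position p i
      ... | before i<p = Joins-cong (sym (splice-< i<p)) (sym (splice-< i<p)) (sym (splice-≤ P→Q i<p))
                                    (edgeAt-joins P i<p)
      ... | after j    = Joins-cong (sym (splice-+ j)) (sym (splice-+ j))
                                    (sym (trans (cong (splice p (vertexAt P) (vertexAt Q)) (sym (+-suc p j))) (splice-+ (suc j))))
                                    (edgeAt-joins Q (+-cancelˡ-< p j q i<p+q))

    close : ClosedPath
    close = record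
      { length             = p + q
      ; 2≤length           = +-mono-≤ P-nonempty Q-nonempty
      ; vertexAt           = splice p (vertexAt P) (vertexAt Q)
      ; edgeAt             = splice p (edgeAt P) (edgeAt Q)
      ; edgeAt-joins       = splice-joins
      ; closed             = trans (splice-+ q) (trans Q→P (sym (splice-< P-nonempty)))
      ; vertexAt-injective = splice-injective
          (λ i<p j<p → vertexAt-injective P (m<n⇒m<1+n i<p) (m<n⇒m<1+n j<p))
          (λ i<q j<q → vertexAt-injective Q (m<n⇒m<1+n i<q) (m<n⇒m<1+n j<q))
          P-vertex≢Q-vertex
      ; edgeAt-injective   = splice-injective (edgeAt-injective P) (edgeAt-injective Q)
          (λ i<p j<q Pi≡Qj → edges-disjoint (_ , i<p , refl) (_ , j<q , sym Pi≡Qj))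
      }

    ∈E-close⁺ˡ : ∀ {e} → e ∈Eₚ P → e ∈E toCircle close
    ∈E-close⁺ˡ (i , i<p , refl) =
      subst (_∈E toCircle close) (splice-< i<p) (∈E-toCircle⁺ close (<-≤-trans i<p (m≤m+n p q)))

    ∈E-close⁺ʳ : ∀ {e} → e ∈Eₚ Q → e ∈E toCircle close
    ∈E-close⁺ʳ (j , j<q , refl) =
      subst (_∈E toCircle close) (splice-+ j) (∈E-toCircle⁺ close (+-monoʳ-< p j<q))

    ∈E-close⁻ : ∀ {e} → e ∈E toCircle close → e ∈Eₚ P ⊎ e ∈Eₚ Q
    ∈E-close⁻ e∈ with ∈E-toCircle⁻ close e∈
    ... | i , i<p+q , refl with position p i
    ...   | before i<p = inj₁ (i , i<p , sym (splice-< i<p))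
    ...   | after j    = inj₂ (j , +-cancelˡ-< p j q i<p+q , sym (splice-+ j))

  module _ (W : Circle Γ) where

    record Bridge : Set where
      field
        path       : Path
        nonempty   : 0 < length path
        start∈W    : vertexAt path 0 ∈V W
        end∈W      : vertexAt path (length path) ∈V W
        interior∉W : ∀ {i} → 0 < i → i < length path → ¬ vertexAt path i ∈V W
        edges∉W    : ∀ {e} → e ∈Eₚ path → ¬ e ∈E W

    module _ (C : Circle Γ) (B : ℕ) where

      private
        OnW : ℕ → Set
        OnW t = cyclicVertex C (B + t) ∈V W

      gap⇒bridge : ∀ {a o b} (G : Gap OnW a o b) → Gap.width G < size C → ¬ cyclicEdge C (B + o) ∈E W →
                   Σ Bridge λ P → ∀ {e} → e ∈Eₚ Bridge.path P → e ∈E C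
      gap⇒bridge {o = o} G w<size bad∉W = P , λ { (i , _ , refl) → cyclicEdge-∈E C (B + r + i) }
        where
          open Gap G renaming (start to r; width to w)
          S = segment C (B + r) w w<size

          S-vertex : ∀ i → vertexAt S i ≡ cyclicVertex C (B + (r + i))
          S-vertex i = cong (cyclicVertex C) (+-assoc B r i)

          interior∉W′ : ∀ {i} → 0 < i → i < w → ¬ vertexAt S i ∈V W
          interior∉W′ {i} 0<i i<w = interior 0<i i<w ∘ subst (_∈V W) (S-vertex i)

          -- Every edge of S has an endpoint inside S, unless S is the single edge at position o.
          edges∉W′ : ∀ {e} → e ∈Eₚ S → ¬ e ∈E W
          edges∉W′ (suc i , i<w , refl) Si∈W = interior∉W′ z<s i<w (∈E-joins⇒∈V W Si∈W (edgeAt-joins S i<w))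
          edges∉W′ (zero , 0<w , refl) S0∈W with m≤n⇒m<n∨m≡n 0<w
          ... | inj₁ 1<w = interior∉W′ z<s 1<w (∈E-joins⇒∈V W S0∈W (Joins-sym (edgeAt-joins S 0<w)))
          ... | inj₂ 1≡w = bad∉W (subst (_∈E W) (cong (cyclicEdge C) B+r+0≡B+o) S0∈W)
            where
              r≡o : r ≡ o
              r≡o = ≤-antisym start≤o (s≤s⁻¹ (subst (o <_) (trans (cong (r +_) (sym 1≡w)) (+-comm r 1)) o<end))
              B+r+0≡B+o : B + r + 0 ≡ B + o
              B+r+0≡B+o = trans (+-identityʳ (B + r)) (cong (B +_) r≡o)

          P : Bridge
          P = record
            { path       = S
            ; nonempty   = +-cancelˡ-< r 0 w (≤-<-trans (≤-reflexive (+-identityʳ r)) (≤-<-trans start≤o o<end))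
            ; start∈W    = subst (_∈V W) (sym (S-vertex 0)) (subst OnW (sym (+-identityʳ r)) Q-start)
            ; end∈W      = subst (_∈V W) (sym (S-vertex w)) Q-end
            ; interior∉W = interior∉W′
            ; edges∉W    = edges∉W′
            }

      -- The gap is taken inside [0, d] or [d, size C], whichever contains o; both are shorter
      -- than C, so the gap is a proper segment of C.
      marked⇒bridge : ∀ {d o} → 0 < d → d < size C → OnW 0 → OnW d → o < size C → ¬ cyclicEdge C (B + o) ∈E W →
                      Σ Bridge λ P → ∀ {e} → e ∈Eₚ Bridge.path P → e ∈E C
      marked⇒bridge {d} {o} 0<d d<size OnW0 OnWd o<size bad with o <? d
      ... | yes o<d = gap⇒bridge G (≤-<-trans (≤-trans (m≤n+m width start) end≤b) d<size) bad
        where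
          G = gap (λ t → ∈V? W (cyclicVertex C (B + t))) OnW0 OnWd z≤n o<d
          open Gap G
      ... | no o≮d  = gap⇒bridge G (<-≤-trans (m<n+m width 0<d) (≤-trans (+-monoˡ-≤ width a≤start) end≤b)) bad
        where
          OnWsize : OnW (size C)
          OnWsize = subst (_∈V W)
                      (sym (trans (cyclic-periodic (vert C) B) (cong (cyclicVertex C) (sym (+-identityʳ B))))) OnW0
          G = gap (λ t → ∈V? W (cyclicVertex C (B + t))) OnWd OnWsize (≮⇒≥ o≮d) o<size
          open Gap G

    bridgeAlong : (C : Circle Γ) {u v : Fin n} {e : Fin m} →
                  u ≢ v → u ∈V W → u ∈V C → v ∈V W → v ∈V C → e ∈E C → ¬ e ∈E W →
                  Σ Bridge λ P → ∀ {e} → e ∈Eₚ Bridge.path P → e ∈E C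
    bridgeAlong C u≢v u∈W (iu , refl) v∈W (iv , refl) (ie , refl) e∉W
      with cyclic-offset (vert C) (toℕ iu) iv | cyclic-offset (edge C) (toℕ iu) ie
    ... | d , d<size , vd | o , o<size , eo =
      marked⇒bridge C B (n≢0⇒n>0 d≢0) d<size (subst (_∈V W) (sym B+0≡u) u∈W) (subst (_∈V W) (sym vd) v∈W) o<size
        (e∉W ∘ subst (_∈E W) eo)
      where
        B = toℕ iu
        B+0≡u : cyclicVertex C (B + 0) ≡ vert C iu
        B+0≡u = trans (cong (cyclicVertex C) (+-identityʳ B)) (cyclic-toℕ (vert C) iu)
        d≢0 : d ≢ 0
        d≢0 refl = u≢v (trans (sym B+0≡u) vd)

  module _ {W : Circle Γ} (P : Bridge W) where

    open Bridge P

    record ThetaCircle : Set where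
      field
        circle        : Circle Γ
        path⊆circle   : ∀ {e} → e ∈Eₚ path → e ∈E circle
        circle⊆path∪W : ∀ {e} → e ∈E circle → e ∈Eₚ path ⊎ e ∈E W
        meetsW        : ∃ λ e → e ∈E W × e ∈E circle

    open ThetaCircle

    private
      x = vertexAt path 0
      y = vertexAt path (length path)

      closeAlong : (Q : Path) → 0 < length Q → vertexAt Q 0 ≡ y → vertexAt Q (length Q) ≡ x →
                   (∀ j → vertexAt Q j ∈V W) → (∀ {e} → e ∈Eₚ Q → e ∈E W) →
                   Σ ThetaCircle λ D → (∀ {e} → e ∈Eₚ Q → e ∈E circle D)
                                     × (∀ {e} → e ∈E W → e ∈E circle D → e ∈Eₚ Q)
      closeAlong Q 0<q Q0≡y Qq≡x Q⊆W Q-edges⊆W = D , ∈E-close⁺ʳ PQ , D∩W⊆Q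
        where
          PQ : Closable path Q
          PQ = record
            { P-nonempty     = nonempty
            ; Q-nonempty     = 0<q
            ; P→Q            = Q0≡y
            ; Q→P            = Qq≡x
            ; P-interior∉Q   = λ {_} {j} 0<i i<p _ Pi≡Qj → interior∉W 0<i i<p (subst (_∈V W) (sym Pi≡Qj) (Q⊆W j))
            ; edges-disjoint = λ e∈P e∈Q → edges∉W e∈P (Q-edges⊆W e∈Q)
            }
          D : ThetaCircle
          D = record
            { circle        = toCircle (close PQ)
            ; path⊆circle   = ∈E-close⁺ˡ PQ
            ; circle⊆path∪W = map₂ Q-edges⊆W ∘ ∈E-close⁻ PQ
            ; meetsW        = edgeAt Q 0 , Q-edges⊆W (0 , 0<q , refl) , ∈E-close⁺ʳ PQ (0 , 0<q , refl)
            }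
          D∩W⊆Q : ∀ {e} → e ∈E W → e ∈E circle D → e ∈Eₚ Q
          D∩W⊆Q e∈W e∈D = [ (λ e∈P → contradiction e∈W (edges∉W e∈P)) , id ] (∈E-close⁻ PQ e∈D)

      module Arcs {tx ty} (tx≡x : vert W tx ≡ x) (ty≡y : vert W ty ≡ y) where

        TY = toℕ ty

        TY+0≡y : cyclicVertex W (TY + 0) ≡ y
        TY+0≡y = trans (cong (cyclicVertex W) (+-identityʳ TY)) (trans (cyclic-toℕ (vert W) ty) ty≡y)

        x-offset = cyclic-offset (vert W) TY tx
        q        = proj₁ x-offset
        q<size   = proj₁ (proj₂ x-offset)
        TY+q≡x   = trans (proj₂ (proj₂ x-offset)) tx≡x

        0<q : 0 < q
        0<q = n≢0⇒n>0 λ q≡0 → <⇒≢ nonempty (vertexAt-injective path z<s (s≤s ≤-refl)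
                (trans (sym TY+q≡x) (trans (cong (λ o → cyclicVertex W (TY + o)) q≡0) TY+0≡y)))

        Q₁ = segment W TY q q<size
        Q₂ = coSegment W TY 0<q q<size
        R₂ = reverse Q₂

        R₂-start : vertexAt R₂ 0 ≡ y
        R₂-start = begin
          cyclicVertex W (TY + q + (size W ∸ q))   ≡⟨ cong (cyclicVertex W) (+-assoc TY q (size W ∸ q)) ⟩
          cyclicVertex W (TY + (q + (size W ∸ q))) ≡⟨ cong (cyclicVertex W ∘ (TY +_)) (m+[n∸m]≡n (<⇒≤ q<size)) ⟩
          cyclicVertex W (TY + size W)             ≡⟨ cyclic-periodic (vert W) TY ⟩
          cyclicVertex W TY                        ≡⟨ cong (cyclicVertex W) (+-identityʳ TY) ⟨
          cyclicVertex W (TY + 0)                  ≡⟨ TY+0≡y ⟩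
          y                                        ∎
          where open ≡-Reasoning

        R₂-end : vertexAt R₂ (length R₂) ≡ x
        R₂-end = trans (reverse-end Q₂) (trans (cong (cyclicVertex W) (+-identityʳ (TY + q))) TY+q≡x)

        theta₁ = closeAlong Q₁ 0<q TY+0≡y TY+q≡x (λ j → cyclicVertex-∈V W (TY + j)) (∈Eₚ-segment⇒∈E W TY q q<size)
        theta₂ = closeAlong R₂ (m<n⇒0<n∸m q<size) R₂-start R₂-end
                   (λ j → cyclicVertex-∈V W (TY + q + (size W ∸ q ∸ j)))
                   (∈Eₚ-segment⇒∈E W (TY + q) (size W ∸ q) (∸-monoʳ-< 0<q (<⇒≤ q<size)) ∘ ∈Eₚ-reverse⁻ Q₂)

        thetaCircles′ : ∀ {e} → e ∈E W →
                        (Σ ThetaCircle λ D → e ∈E circle D) × (Σ ThetaCircle λ D → ¬ e ∈E circle D)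
        thetaCircles′ e∈W with theta₁ | theta₂ | ∈E-segment⊎coSegment W TY 0<q q<size e∈W
        ... | D₁ , Q₁⊆D₁ , D₁∩W⊆Q₁ | D₂ , R₂⊆D₂ , D₂∩W⊆R₂ | inj₁ (e∈Q₁ , e∉Q₂) =
          (D₁ , Q₁⊆D₁ e∈Q₁) , (D₂ , e∉Q₂ ∘ ∈Eₚ-reverse⁻ Q₂ ∘ D₂∩W⊆R₂ e∈W)
        ... | D₁ , Q₁⊆D₁ , D₁∩W⊆Q₁ | D₂ , R₂⊆D₂ , D₂∩W⊆R₂ | inj₂ (e∈Q₂ , e∉Q₁) =
          (D₂ , R₂⊆D₂ (∈Eₚ-reverse⁺ Q₂ e∈Q₂)) , (D₁ , e∉Q₁ ∘ D₁∩W⊆Q₁ e∈W)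

    thetaCircles : ∀ {e} → e ∈E W →
                   (Σ ThetaCircle λ D → e ∈E circle D) × (Σ ThetaCircle λ D → ¬ e ∈E circle D)
    thetaCircles = Arcs.thetaCircles′ (proj₂ start∈W) (proj₂ end∈W)

  AtMostOneNegative : (Fin m → Set) → Set
  AtMostOneNegative S = ∀ {e e′} → S e → S e′ → sign Γ e ≡ neg → sign Γ e′ ≡ neg → e ≡ e′

  negative? : ∀ s → Dec (s ≡ neg)
  negative? pos = no λ ()
  negative? neg = yes refl

  weaklyNegative-intro : ∀ (D : Circle Γ) {e} → e ∈E D → sign Γ e ≡ neg →
                         (∀ {e′} → e′ ∈E D → sign Γ e′ ≡ neg → e′ ≡ e) → WeaklyNegative D
  weaklyNegative-intro D (i , refl) e-neg unique = i , e-neg , λ j → edgeInj D ∘ unique (j , refl)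

  weaklyNegative⇒atMostOneNegative : ∀ (C : Circle Γ) → WeaklyNegative C → AtMostOneNegative (_∈E C)
  weaklyNegative⇒atMostOneNegative C (_ , _ , unique) (j , refl) (j′ , refl) j-neg j′-neg =
    cong (edge C) (trans (unique j j-neg) (sym (unique j′ j′-neg)))

  allPositive⇒¬negative : ∀ (C : Circle Γ) → AllPositive C → ∀ {e} → e ∈E C → sign Γ e ≢ neg
  allPositive⇒¬negative C C-pos (j , refl) j-neg with trans (sym (C-pos j)) j-neg
  ... | ()

  negativeEdge? : (P : Path) → Dec (∃ λ e → e ∈Eₚ P × sign Γ e ≡ neg)
  negativeEdge? P with any? (λ (i : Fin (length P)) → negative? (sign Γ (edgeAt P (toℕ i))))
  ... | yes (i , i-neg) = yes (_ , (toℕ i , toℕ<n i , refl) , i-neg)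
  ... | no none         = no λ { (_ , (i , i<p , refl) , i-neg) →
    none (fromℕ< i<p , subst (λ j → sign Γ (edgeAt P j) ≡ neg) (sym (toℕ-fromℕ< i<p)) i-neg) }

  module _ (W : Circle Γ) (W-wn : WeaklyNegative W)
           (isolated : ∀ (C : Circle Γ) → WeaklyNegative C → ¬ SameCircle C W → EdgeDisjoint W C) where

    open ThetaCircle

    private
      e* = edge W (proj₁ W-wn)
      e*∈W : e* ∈E W
      e*∈W = proj₁ W-wn , refl
      e*-neg : sign Γ e* ≡ neg
      e*-neg = proj₁ (proj₂ W-wn)
      W-oneNeg : AtMostOneNegative (_∈E W)
      W-oneNeg = weaklyNegative⇒atMostOneNegative W W-wn

    module _ (P : Bridge W) where

      open Bridge P

      theta-¬weaklyNegative : (D : ThetaCircle P) → ¬ WeaklyNegative (circle D)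
      theta-¬weaklyNegative D D-wn with meetsW D
      ... | e , e∈W , e∈D = isolated (circle D) D-wn D≢W e e∈W e∈D
        where
          first∈P : edgeAt path 0 ∈Eₚ path
          first∈P = 0 , nonempty , refl
          D≢W : ¬ SameCircle (circle D) W
          D≢W D≡W = edges∉W first∈P (proj₁ (D≡W _) (path⊆circle D first∈P))

      bridge⇒¬atMostOneNegative : ¬ AtMostOneNegative (_∈Eₚ path)
      bridge⇒¬atMostOneNegative path-oneNeg with negativeEdge? path
      ... | yes (e₀ , e₀∈P , e₀-neg) with proj₂ (thetaCircles P e*∈W)
      ...   | D , e*∉D =
        theta-¬weaklyNegative D (weaklyNegative-intro (circle D) (path⊆circle D e₀∈P) e₀-neg only-e₀)
        where
          only-e₀ : ∀ {e} → e ∈E circle D → sign Γ e ≡ neg → e ≡ e₀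
          only-e₀ e∈D e-neg with circle⊆path∪W D e∈D
          ... | inj₁ e∈P = path-oneNeg e∈P e₀∈P e-neg e₀-neg
          ... | inj₂ e∈W = contradiction (subst (_∈E circle D) (W-oneNeg e∈W e*∈W e-neg e*-neg) e∈D) e*∉D
      bridge⇒¬atMostOneNegative path-oneNeg | no noNeg with proj₁ (thetaCircles P e*∈W)
      ...   | D , e*∈D = theta-¬weaklyNegative D (weaklyNegative-intro (circle D) e*∈D e*-neg only-e*)
        where
          only-e* : ∀ {e} → e ∈E circle D → sign Γ e ≡ neg → e ≡ e*
          only-e* e∈D e-neg with circle⊆path∪W D e∈D
          ... | inj₁ e∈P = contradiction (_ , e∈P , e-neg) noNeg
          ... | inj₂ e∈W = W-oneNeg e∈W e*∈W e-neg e*-neg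

    atMostOneCommonVertex : (C : Circle Γ) → AtMostOneNegative (_∈E C) → (∃ λ e → e ∈E C × ¬ e ∈E W) →
                            AtMostOneCommonVertex W C
    atMostOneCommonVertex C C-oneNeg (e , e∈C , e∉W) u v u∈W u∈C v∈W v∈C with u ≟ᶠ v
    ... | yes u≡v = u≡v
    ... | no u≢v with bridgeAlong W C u≢v u∈W u∈C v∈W v∈C e∈C e∉W
    ...   | P , P⊆C = ⊥-elim (bridge⇒¬atMostOneNegative P (λ e∈P e′∈P → C-oneNeg (P⊆C e∈P) (P⊆C e′∈P)))

mainTheorem2 : {n m : ℕ} (Σ : SignedGraph n m) (W : Circle Σ) →
               WeaklyNegative W →
               (∀ (C : Circle Σ) → WeaklyNegative C → ¬ SameCircle C W → EdgeDisjoint W C) →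
               (∀ (C : Circle Σ) → AllPositive C → AtMostOneCommonVertex W C)
               × (∀ (C : Circle Σ) → WeaklyNegative C → ¬ SameCircle C W → AtMostOneCommonVertex W C)
mainTheorem2 Σ W W-wn isolated = allPositive , weaklyNegative
  where
    allPositive : ∀ (C : Circle Σ) → AllPositive C → AtMostOneCommonVertex W C
    allPositive C C-pos with all? (λ j → ∈E? Σ W (edge C j))
    ... | yes C⊆W = ⊥-elim (allPositive⇒¬negative Σ C C-pos
                      (circle⊆circle⇒⊇ Σ W C (λ { (j , refl) → C⊆W j }) (proj₁ W-wn , refl)) (proj₁ (proj₂ W-wn)))
    ... | no C⊈W with ¬∀⟶∃¬ _ _ (λ j → ∈E? Σ W (edge C j)) C⊈W
    ...   | j , j∉W = atMostOneCommonVertex Σ W W-wn isolated C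
                        (λ e∈C _ e-neg _ → ⊥-elim (allPositive⇒¬negative Σ C C-pos e∈C e-neg))
                        (edge C j , (j , refl) , j∉W)

    weaklyNegative : ∀ (C : Circle Σ) → WeaklyNegative C → ¬ SameCircle C W → AtMostOneCommonVertex W C
    weaklyNegative C C-wn C≢W = atMostOneCommonVertex Σ W W-wn isolated C (weaklyNegative⇒atMostOneNegative Σ C C-wn)
      (edge C zero , (zero , refl) , λ C₀∈W → isolated C C-wn C≢W _ C₀∈W (zero , refl))
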